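{- Let $d\ge1$, $V$ a finite set of boxes, $w: V\to\mathbb{Q}_{\ge0}^d$ a size function and $W\in\mathbb{Q}_{>0}^d$ a container size. Let $E=(E_1,\dots,E_d)$ be a packing class for $(V,w)$, let $i\in\{1,\dots,d\}$, $G_i=(V,E_i)$, and $S\subseteq V$. Then the induced subgraph $G_i[S]$ contains a clique of size $\left\lceil \frac{\sum_{s\in S} w_i(s)}{W_i}\right\rceil$.
   Context: A set $T\subseteq V$ is $x_i$-feasible if $\sum_{b\in T}w_i(b)\le W_i$. A packing class for $(V,w)$ (with respect to container $W$) is a tuple $E=(E_1,\dots,E_d)$ of edge sets of simple undirected graphs on vertex set $V$ such that P1: each $G_i=(V,E_i)$ is an interval graph; P2: every stable set of $G_i$ is $x_i$-feasible, for each $i$; P3: $\bigcap_{i=1}^d E_i=\emptyset$. $G_i[S]$ denotes the subgraph of $G_i$ induced by $S$. -}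

module Defs where

open import Data.Nat using (ℕ; zero; suc)
open import Data.Bool using (Bool; true; false)
open import Data.Fin using (Fin)
open import Data.Fin.Subset using (Subset; _∈_; _⊆_; ∣_∣)
open import Data.Vec using (Vec; []; _∷_)
open import Data.Rational using (ℚ; 0ℚ; _+_; _≤_; _÷_; Positive)
open import Data.Rational.Properties using (pos⇒nonZero)
open import Data.Integer using (ℤ)
open import Data.Product using (Σ; _×_)
open import Relation.Binary.PropositionalEquality using (_≡_; _≢_)
open import Relation.Nullary using (¬_)

Graph : ℕ → Set
Graph n = Fin n → Fin n → Bool

IsSimple : ∀ {n} → Graph n → Set
IsSimple {n} E = (∀ (v : Fin n) → E v v ≡ false) × (∀ (u v : Fin n) → E u v ≡ E v u)

-- interval graph: there are closed intervals [a v , b v] (a v ≤ b v) such that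
-- distinct u, v are adjacent iff their intervals intersect.
-- (Rational endpoints suffice for finite graphs.)
IsIntervalGraph : ∀ {n} → Graph n → Set
IsIntervalGraph {n} E =
  Σ (Fin n → ℚ) λ a → Σ (Fin n → ℚ) λ b →
    (∀ v → a v ≤ b v) ×
    (∀ u v → u ≢ v → (E u v ≡ true → (a u ≤ b v × a v ≤ b u))
                   × ((a u ≤ b v × a v ≤ b u) → E u v ≡ true))

sumOver : ∀ {n} → Subset n → (Fin n → ℚ) → ℚ
sumOver {zero} [] f = 0ℚ
sumOver {suc n} (true ∷ T) f = f Fin.zero + sumOver T (λ k → f (Fin.suc k))
sumOver {suc n} (false ∷ T) f = sumOver T (λ k → f (Fin.suc k))

IsStable : ∀ {n} → Graph n → Subset n → Set
IsStable E T = ∀ u v → u ∈ T → v ∈ T → E u v ≡ false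

IsClique : ∀ {n} → Graph n → Subset n → Set
IsClique E K = ∀ u v → u ∈ K → v ∈ K → u ≢ v → E u v ≡ true

record IsPackingClass {d n : ℕ} (w : Fin d → Fin n → ℚ) (W : Fin d → ℚ)
                      (E : Fin d → Graph n) : Set where
  field
    simple   : ∀ i → IsSimple (E i)
    P1       : ∀ i → IsIntervalGraph (E i)
    P2       : ∀ i (T : Subset n) → IsStable (E i) T → sumOver T (w i) ≤ W i
    P3       : ∀ (u v : Fin n) → ¬ (∀ i → E i u v ≡ true)

ceilDiv : (p q : ℚ) → .{{Positive q}} → ℤ
ceilDiv p q = Data.Rational.ceiling ((p ÷ q) {{pos⇒nonZero q}})

{-# OPTIONS --safe #-}
module Submission where

-- Greedily taking the interval with the leftmost left end and discarding its
-- neighbours yields a stable set T ⊆ S whose intervals contain the left end of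
-- every other vertex of S. In a clique K of S ∖ T, the largest left end a k lies
-- in every interval of K (intervals have the Helly property), and also in some
-- interval of T, whose vertex therefore extends K. As T is stable, w(S ∩ T) ≤ W,
-- so induction on |S| gives a clique K ⊆ S with w(S) ≤ |K|·W, i.e.
-- |K| ≥ ⌈w(S)/W⌉, and any subset of K of exactly that size is still a clique.
-- Only P1 and P2 for the coordinate i are needed.

open import Algebra.Bundles using (Ring)
open import Data.Bool using (true; false)
open import Data.Bool.Properties using (¬-not; not-¬)
open import Data.Empty using (⊥-elim)
open import Data.Fin using (Fin; zero; suc)
open import Data.Fin.Properties using (_≟_)
open import Data.Fin.Subset
  using (Subset; inside; outside; _∈_; _∉_; _⊆_; ∣_∣; ⊥; ⁅_⁆; _∪_; _∩_; _─_; _-_; Empty; Nonempty)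
open import Data.Fin.Subset.Properties
  using (∉⊥; ∣⊥∣≡0; ⊆-min; s⊆s; x∈⁅x⁆; x∈⁅y⁆⇒x≡y; ∪-identityʳ; p⊆p∪q; x∈p∪q⁺; x∈p∪q⁻;
         x∈p∩q⁺; p∩q⊆q; p─q⊆p; x∈p∧x∉q⇒x∈p─q; x≢y⇒x∉⁅y⁆; p⊆q⇒∣p∣≤∣q∣; x∈p⇒∣p-x∣<∣p∣;
         p∩q≢∅⇒∣p─q∣<∣p∣; nonempty?; Empty-unique)
open import Data.Integer as ℤ using (ℤ; +_; 0ℤ)
import Data.Integer.Properties as ℤ
open import Data.Integer.DivMod using ([n/d]*d≤n; n<s[n/ℕd]*d; div-pos-is-/ℕ)
open import Data.Nat using (ℕ; zero; suc; s≤s; _≤_; _<_)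
open import Data.Nat.Induction using (<-wellFounded)
open import Data.Nat.Properties using (≤-<-trans)
open import Data.Product using (Σ; ∃; _×_; _,_; proj₁; proj₂)
open import Data.Rational using (ℚ; 0ℚ; Positive)
open import Data.Rational as ℚ using (mkℚ; ↥_; ↧_; ↧ₙ_; 1ℚ; _+_; _*_; *≤*; floor; ceiling; -_)
open import Data.Rational.Literals using (fromℤ)
import Data.Rational.Properties as ℚ
import Data.Rational.Unnormalised as ℚᵘ
import Data.Rational.Unnormalised.Properties as ℚᵘ
open import Data.Sum using (_⊎_; inj₁; inj₂)
open import Data.Vec using ([]; _∷_; tabulate; here; there)
open import Data.Vec.Properties using (lookup∘tabulate; []=⇒lookup; lookup⇒[]=)
open import Function using (_∘_)
open import Induction.WellFounded using (Acc; acc)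
open import Relation.Binary.Bundles using (TotalPreorder)
import Relation.Binary.Construct.Flip.EqAndOrd as Flip
open import Relation.Binary.PropositionalEquality
open import Relation.Nullary using (yes; no)

open import Algebra.Properties.Semiring.Mult (Ring.semiring ℚ.+-*-ring)
  using (×-assoc-*) renaming (_×_ to _·_)
open import Defs

-- floor and ceiling match on the record constructor, so they unfold only on an explicit mkℚ.
floor≡↥/ℕ↧ : ∀ y → floor y ≡ ↥ y ℤ./ℕ ↧ₙ y
floor≡↥/ℕ↧ y@(mkℚ _ _ _) = div-pos-is-/ℕ (↥ y) (↧ₙ y)

ceiling≡-floor- : ∀ x → ceiling x ≡ ℤ.- floor (- x)
ceiling≡-floor- (mkℚ _ _ _) = refl

fromℤ-neg : ∀ j → fromℤ (ℤ.- j) ≡ - fromℤ j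
fromℤ-neg ℤ.-[1+ _ ] = refl
fromℤ-neg (+ zero)   = refl
fromℤ-neg (+ suc _)  = refl

≤fromℤ⇒floor≤ : ∀ {y} j → y ℚ.≤ fromℤ j → floor y ℤ.≤ j
≤fromℤ⇒floor≤ {y@(mkℚ _ _ _)} j (*≤* ↥y≤j↧y) = ℤ.*-cancelʳ-≤-pos (floor y) j (↧ y) (begin
  floor y ℤ.* ↧ y  ≤⟨ [n/d]*d≤n (↥ y) (↧ y) ⟩
  ↥ y              ≡⟨ sym (ℤ.*-identityʳ (↥ y)) ⟩
  ↥ y ℤ.* + 1      ≤⟨ ↥y≤j↧y ⟩
  j ℤ.* ↧ y        ∎)
  where open ℤ.≤-Reasoning

fromℤ≤⇒≤floor : ∀ {y} j → fromℤ j ℚ.≤ y → j ℤ.≤ floor y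
fromℤ≤⇒≤floor {y} j (*≤* j↧y≤↥y) =
  subst₂ ℤ._≤_ (ℤ.pred-suc j) (ℤ.pred-suc (floor y)) (ℤ.pred-mono (ℤ.i<j⇒suc[i]≤j j<1+⌊y⌋))
  where
  open ℤ.≤-Reasoning
  j<1+⌊y⌋ : j ℤ.< ℤ.suc (floor y)
  j<1+⌊y⌋ = ℤ.*-cancelʳ-<-nonNeg {j} {ℤ.suc (floor y)} (↧ y) (begin-strict
    j ℤ.* ↧ y                      ≤⟨ j↧y≤↥y ⟩
    ↥ y ℤ.* + 1                    ≡⟨ ℤ.*-identityʳ (↥ y) ⟩
    ↥ y                            <⟨ n<s[n/ℕd]*d (↥ y) (↧ₙ y) ⟩
    ℤ.suc (↥ y ℤ./ℕ ↧ₙ y) ℤ.* ↧ y  ≡⟨ cong (λ z → ℤ.suc z ℤ.* ↧ y) (sym (floor≡↥/ℕ↧ y)) ⟩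
    ℤ.suc (floor y) ℤ.* ↧ y        ∎)

≤fromℤ⇒ceiling≤ : ∀ {x} j → x ℚ.≤ fromℤ j → ceiling x ℤ.≤ j
≤fromℤ⇒ceiling≤ {x} j x≤j = begin
  ceiling x        ≡⟨ ceiling≡-floor- x ⟩
  ℤ.- floor (- x)  ≤⟨ ℤ.neg-mono-≤ (fromℤ≤⇒≤floor (ℤ.- j) -j≤-x) ⟩
  ℤ.- (ℤ.- j)      ≡⟨ ℤ.neg-involutive j ⟩
  j                ∎
  where
  open ℤ.≤-Reasoning
  -j≤-x : fromℤ (ℤ.- j) ℚ.≤ - x
  -j≤-x = subst (λ z → z ℚ.≤ - x) (sym (fromℤ-neg j)) (ℚ.neg-antimono-≤ x≤j)

fromℤ≤⇒≤ceiling : ∀ {x} j → fromℤ j ℚ.≤ x → j ℤ.≤ ceiling x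
fromℤ≤⇒≤ceiling {x} j j≤x = begin
  j                ≡⟨ sym (ℤ.neg-involutive j) ⟩
  ℤ.- (ℤ.- j)      ≤⟨ ℤ.neg-mono-≤ (≤fromℤ⇒floor≤ (ℤ.- j) -x≤-j) ⟩
  ℤ.- floor (- x)  ≡⟨ sym (ceiling≡-floor- x) ⟩
  ceiling x        ∎
  where
  open ℤ.≤-Reasoning
  -x≤-j : - x ℚ.≤ fromℤ (ℤ.- j)
  -x≤-j = subst (λ z → - x ℚ.≤ z) (sym (fromℤ-neg j)) (ℚ.neg-antimono-≤ j≤x)

1+fromℤ≡fromℤ-suc : ∀ k → 1ℚ + fromℤ (+ k) ≡ fromℤ (+ suc k)
1+fromℤ≡fromℤ-suc k = ℚ.toℚᵘ-injective (ℚᵘ.≃-trans (ℚ.toℚᵘ-homo-+ 1ℚ (fromℤ (+ k))) (ℚᵘ.*≡* (begin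
  (ℤ.1ℤ ℤ.+ + k ℤ.* + 1) ℤ.* + 1  ≡⟨ ℤ.*-identityʳ _ ⟩
  ℤ.1ℤ ℤ.+ + k ℤ.* + 1            ≡⟨ cong (ℤ._+_ ℤ.1ℤ) (ℤ.*-identityʳ (+ k)) ⟩
  + suc k                         ≡⟨ sym (ℤ.*-identityʳ (+ suc k)) ⟩
  + suc k ℤ.* + 1                 ∎)))
  where open ≡-Reasoning

·1ℚ≡fromℤ : ∀ k → k · 1ℚ ≡ fromℤ (+ k)
·1ℚ≡fromℤ zero    = refl
·1ℚ≡fromℤ (suc k) = trans (cong (λ q → 1ℚ + q) (·1ℚ≡fromℤ k)) (1+fromℤ≡fromℤ-suc k)

ceilDiv-natural-≤ : ∀ {p q k} {{q>0 : Positive q}} → 0ℚ ℚ.≤ p → p ℚ.≤ k · q →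
                    Σ ℕ λ m → m ≤ k × ceilDiv p q ≡ + m
ceilDiv-natural-≤ {p} {q} {k} 0≤p p≤kq =
  ℤ.∣ ⌈x⌉ ∣ , ℤ.drop‿+≤+ (subst (ℤ._≤ + k) (sym +∣⌈x⌉∣≡⌈x⌉) (≤fromℤ⇒ceiling≤ (+ k) x≤k)) , sym +∣⌈x⌉∣≡⌈x⌉
  where
  instance
    q≢0 : ℚ.NonZero q
    q≢0 = ℚ.pos⇒nonZero q
    1/q≥0 : ℚ.NonNegative (ℚ.1/ q)
    1/q≥0 = ℚ.pos⇒nonNeg (ℚ.1/ q) {{ℚ.1/pos⇒pos q}}
  x = p ℚ.÷ q
  ⌈x⌉ = ceiling x
  0≤x : 0ℚ ℚ.≤ x
  0≤x = subst (λ z → z ℚ.≤ x) (ℚ.*-zeroˡ (ℚ.1/ q)) (ℚ.*-monoʳ-≤-nonNeg (ℚ.1/ q) 0≤p)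
  x≤k : x ℚ.≤ fromℤ (+ k)
  x≤k = begin
    p * ℚ.1/ q        ≤⟨ ℚ.*-monoʳ-≤-nonNeg (ℚ.1/ q) p≤kq ⟩
    (k · q) * ℚ.1/ q  ≡⟨ ×-assoc-* k q (ℚ.1/ q) ⟩
    k · (q * ℚ.1/ q)  ≡⟨ cong (k ·_) (ℚ.*-inverseʳ q) ⟩
    k · 1ℚ            ≡⟨ ·1ℚ≡fromℤ k ⟩
    fromℤ (+ k)       ∎
    where open ℚ.≤-Reasoning
  +∣⌈x⌉∣≡⌈x⌉ : + ℤ.∣ ⌈x⌉ ∣ ≡ ⌈x⌉
  +∣⌈x⌉∣≡⌈x⌉ = ℤ.0≤i⇒+∣i∣≡i (fromℤ≤⇒≤ceiling 0ℤ 0≤x)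

x∈p─q⇒x∉q : ∀ {n} {x : Fin n} (p q : Subset n) → x ∈ p ─ q → x ∉ q
x∈p─q⇒x∉q (_       ∷ p) (_      ∷ q) (there x∈p─q) (there x∈q) = x∈p─q⇒x∉q p q x∈p─q x∈q
x∈p─q⇒x∉q (inside  ∷ p) (inside ∷ q) () here
x∈p─q⇒x∉q (outside ∷ p) (inside ∷ q) () here

x∈tabulate⁺ : ∀ {n} {f : Fin n → _} {x} → f x ≡ true → x ∈ tabulate f
x∈tabulate⁺ {f = f} {x} fx≡true = lookup⇒[]= x (tabulate f) (trans (lookup∘tabulate f x) fx≡true)

x∈tabulate⁻ : ∀ {n} {f : Fin n → _} {x} → x ∈ tabulate f → f x ≡ true
x∈tabulate⁻ {f = f} {x} x∈ = trans (sym (lookup∘tabulate f x)) ([]=⇒lookup x∈)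

∣p∪⁅x⁆∣≡1+∣p∣ : ∀ {n} {x : Fin n} (p : Subset n) → x ∉ p → ∣ p ∪ ⁅ x ⁆ ∣ ≡ suc ∣ p ∣
∣p∪⁅x⁆∣≡1+∣p∣ {x = zero}  (inside  ∷ p) x∉p = ⊥-elim (x∉p here)
∣p∪⁅x⁆∣≡1+∣p∣ {x = zero}  (outside ∷ p) _   = cong (λ q → suc ∣ q ∣) (∪-identityʳ p)
∣p∪⁅x⁆∣≡1+∣p∣ {x = suc x} (inside  ∷ p) x∉p = cong suc (∣p∪⁅x⁆∣≡1+∣p∣ p (λ x∈p → x∉p (there x∈p)))
∣p∪⁅x⁆∣≡1+∣p∣ {x = suc x} (outside ∷ p) x∉p = ∣p∪⁅x⁆∣≡1+∣p∣ p (λ x∈p → x∉p (there x∈p))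

subset-of-size : ∀ {n m} (p : Subset n) → m ≤ ∣ p ∣ → Σ (Subset n) λ q → q ⊆ p × ∣ q ∣ ≡ m
subset-of-size {n} {zero} p _ = ⊥ , ⊆-min p , ∣⊥∣≡0 n
subset-of-size {m = suc m} (inside ∷ p) (s≤s m≤∣p∣) with subset-of-size p m≤∣p∣
... | q , q⊆p , ∣q∣≡m = inside ∷ q , s⊆s q⊆p , cong suc ∣q∣≡m
subset-of-size {m = suc m} (outside ∷ p) m≤∣p∣ with subset-of-size p m≤∣p∣
... | q , q⊆p , ∣q∣≡m = outside ∷ q , s⊆s q⊆p , ∣q∣≡m

sumOver-⊥ : ∀ {n} (f : Fin n → ℚ) → sumOver ⊥ f ≡ 0ℚ
sumOver-⊥ {zero}  f = refl
sumOver-⊥ {suc n} f = sumOver-⊥ (λ k → f (suc k))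

sumOver-nonNeg : ∀ {n} (p : Subset n) {f : Fin n → ℚ} → (∀ x → 0ℚ ℚ.≤ f x) → 0ℚ ℚ.≤ sumOver p f
sumOver-nonNeg []            f≥0 = ℚ.≤-refl
sumOver-nonNeg (inside  ∷ p) f≥0 = ℚ.+-mono-≤ (f≥0 zero) (sumOver-nonNeg p (λ x → f≥0 (suc x)))
sumOver-nonNeg (outside ∷ p) f≥0 = sumOver-nonNeg p (λ x → f≥0 (suc x))

sumOver-∩-─ : ∀ {n} (p q : Subset n) (f : Fin n → ℚ) →
              sumOver p f ≡ sumOver (p ∩ q) f + sumOver (p ─ q) f
sumOver-∩-─ []            []            f = refl
sumOver-∩-─ (inside  ∷ p) (inside  ∷ q) f =
  trans (cong (_+_ (f zero)) (sumOver-∩-─ p q _)) (sym (ℚ.+-assoc (f zero) _ _))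
sumOver-∩-─ (inside  ∷ p) (outside ∷ q) f = begin
  f zero + sumOver p g              ≡⟨ cong (_+_ (f zero)) (sumOver-∩-─ p q g) ⟩
  f zero + (sumOver (p ∩ q) g + r)  ≡⟨ sym (ℚ.+-assoc (f zero) _ r) ⟩
  f zero + sumOver (p ∩ q) g + r    ≡⟨ cong (_+ r) (ℚ.+-comm (f zero) _) ⟩
  sumOver (p ∩ q) g + f zero + r    ≡⟨ ℚ.+-assoc (sumOver (p ∩ q) g) (f zero) r ⟩
  sumOver (p ∩ q) g + (f zero + r)  ∎
  where
  open ≡-Reasoning
  g = λ x → f (suc x)
  r = sumOver (p ─ q) g
sumOver-∩-─ (outside ∷ p) (inside  ∷ q) f = sumOver-∩-─ p q _
sumOver-∩-─ (outside ∷ p) (outside ∷ q) f = sumOver-∩-─ p q _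

module _ {c ℓ₁ ℓ₂} (O : TotalPreorder c ℓ₁ ℓ₂) where
  open TotalPreorder O using (_≲_; total) renaming (Carrier to A; refl to ≲-refl; trans to ≲-trans)

  empty⊎argmin : ∀ {n} (f : Fin n → A) (p : Subset n) →
                 Empty p ⊎ ∃ λ x → x ∈ p × ∀ y → y ∈ p → f x ≲ f y
  empty⊎argmin f [] = inj₁ λ ()
  empty⊎argmin f (s ∷ p) with empty⊎argmin (λ x → f (suc x)) p
  empty⊎argmin f (outside ∷ p) | inj₁ p=∅ = inj₁ λ { (suc x , there x∈p) → p=∅ (x , x∈p) }
  empty⊎argmin f (inside  ∷ p) | inj₁ p=∅ = inj₂ (zero , here , λ
    { zero _ → ≲-refl ; (suc y) (there y∈p) → ⊥-elim (p=∅ (y , y∈p)) })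
  empty⊎argmin f (outside ∷ p) | inj₂ (x , x∈p , min) = inj₂ (suc x , there x∈p , λ
    { (suc y) (there y∈p) → min y y∈p })
  empty⊎argmin f (inside  ∷ p) | inj₂ (x , x∈p , min) with total (f zero) (f (suc x))
  ... | inj₁ f0≲fx = inj₂ (zero , here , λ
    { zero _ → ≲-refl ; (suc y) (there y∈p) → ≲-trans f0≲fx (min y y∈p) })
  ... | inj₂ fx≲f0 = inj₂ (suc x , there x∈p , λ
    { zero _ → fx≲f0 ; (suc y) (there y∈p) → min y y∈p })

x∈p∪⁅y⁆⁻ : ∀ {n} {x y : Fin n} (p : Subset n) → x ∈ p ∪ ⁅ y ⁆ → x ∈ p ⊎ x ≡ y
x∈p∪⁅y⁆⁻ {y = y} p x∈ with x∈p∪q⁻ p ⁅ y ⁆ x∈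
... | inj₁ x∈p = inj₁ x∈p
... | inj₂ x∈⁅y⁆ = inj₂ (x∈⁅y⁆⇒x≡y y x∈⁅y⁆)

y∈p∪⁅y⁆ : ∀ {n} (p : Subset n) (y : Fin n) → y ∈ p ∪ ⁅ y ⁆
y∈p∪⁅y⁆ p y = x∈p∪q⁺ (inj₂ (x∈⁅x⁆ y))

clique-⊆ : ∀ {n} {E : Graph n} {K L} → L ⊆ K → IsClique E K → IsClique E L
clique-⊆ L⊆K K-clique u v u∈L v∈L = K-clique u v (L⊆K u∈L) (L⊆K v∈L)

clique-∪-⁅⁆ : ∀ {n} {E : Graph n} → (∀ u v → E u v ≡ E v u) → ∀ {K t} → IsClique E K →
              (∀ v → v ∈ K → v ≢ t → E t v ≡ true) → IsClique E (K ∪ ⁅ t ⁆)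
clique-∪-⁅⁆ E-sym {K} {t} K-clique t~K u v u∈ v∈ u≢v with x∈p∪⁅y⁆⁻ K u∈ | x∈p∪⁅y⁆⁻ K v∈
... | inj₁ u∈K | inj₁ v∈K = K-clique u v u∈K v∈K u≢v
... | inj₁ u∈K | inj₂ refl = trans (E-sym u t) (t~K u u∈K u≢v)
... | inj₂ refl | inj₁ v∈K = t~K v v∈K (u≢v ∘ sym)
... | inj₂ refl | inj₂ refl = ⊥-elim (u≢v refl)

module IntervalGraph {n} {E : Graph n} (simple : IsSimple E) (interval : IsIntervalGraph E) where

  a b : Fin n → ℚ
  a = proj₁ interval
  b = proj₁ (proj₂ interval)

  a≤b : ∀ v → a v ℚ.≤ b v
  a≤b = proj₁ (proj₂ (proj₂ interval))

  adjacent⇔meet : ∀ u v → u ≢ v →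
                  (E u v ≡ true → a u ℚ.≤ b v × a v ℚ.≤ b u) × (a u ℚ.≤ b v × a v ℚ.≤ b u → E u v ≡ true)
  adjacent⇔meet = proj₂ (proj₂ (proj₂ interval))

  Contains : Fin n → ℚ → Set
  Contains v x = a v ℚ.≤ x × x ℚ.≤ b v

  common-point⇒adjacent : ∀ {u v x} → u ≢ v → Contains u x → Contains v x → E u v ≡ true
  common-point⇒adjacent {u} {v} u≢v (au≤x , x≤bu) (av≤x , x≤bv) =
    proj₂ (adjacent⇔meet u v u≢v) (ℚ.≤-trans au≤x x≤bv , ℚ.≤-trans av≤x x≤bu)

  clique-contains-max-left-end : ∀ {K k} → IsClique E K → k ∈ K → (∀ v → v ∈ K → a v ℚ.≤ a k) →
                                 ∀ v → v ∈ K → Contains v (a k)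
  clique-contains-max-left-end {k = k} K-clique k∈K k-max v v∈K with v ≟ k
  ... | yes refl = ℚ.≤-refl , a≤b k
  ... | no v≢k   = k-max v v∈K , proj₂ (proj₁ (adjacent⇔meet v k v≢k) (K-clique v k v∈K k∈K v≢k))

  _─N[_] : Subset n → Fin n → Subset n
  S ─N[ s ] = S - s ─ tabulate (E s)

  record StableCover (S : Subset n) : Set where
    field
      T        : Subset n
      T⊆S      : T ⊆ S
      stable   : IsStable E T
      nonempty : Nonempty S → Nonempty T
      covers   : ∀ {u} → u ∈ S → u ∉ T → ∃ λ t → t ∈ T × Contains t (a u)

  leftmost-extends-cover : ∀ {S s} → s ∈ S → (∀ u → u ∈ S → a s ℚ.≤ a u) →
                           StableCover (S ─N[ s ]) → StableCover S
  leftmost-extends-cover {S} {s} s∈S s-min C' = record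
    { T        = T' ∪ ⁅ s ⁆
    ; T⊆S      = T⊆S
    ; stable   = stable
    ; nonempty = λ _ → s , y∈p∪⁅y⁆ T' s
    ; covers   = covers
    }
    where
    open StableCover C' renaming (T to T'; T⊆S to T'⊆S'; stable to T'-stable; covers to T'-covers)
    s≁S' : ∀ {u} → u ∈ S ─N[ s ] → E s u ≡ false
    s≁S' u∈S' = ¬-not (x∈p─q⇒x∉q (S - s) (tabulate (E s)) u∈S' ∘ x∈tabulate⁺)
    ∈S'⁺ : ∀ {u} → u ∈ S → u ≢ s → E s u ≡ false → u ∈ S ─N[ s ]
    ∈S'⁺ u∈S u≢s s≁u =
      x∈p∧x∉q⇒x∈p─q (x∈p∧x∉q⇒x∈p─q u∈S (x≢y⇒x∉⁅y⁆ u≢s)) (not-¬ s≁u ∘ x∈tabulate⁻)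
    T⊆S : T' ∪ ⁅ s ⁆ ⊆ S
    T⊆S u∈T with x∈p∪⁅y⁆⁻ T' u∈T
    ... | inj₁ u∈T' = p─q⊆p S ⁅ s ⁆ (p─q⊆p (S - s) (tabulate (E s)) (T'⊆S' u∈T'))
    ... | inj₂ refl = s∈S
    stable : IsStable E (T' ∪ ⁅ s ⁆)
    stable u v u∈T v∈T with x∈p∪⁅y⁆⁻ T' u∈T | x∈p∪⁅y⁆⁻ T' v∈T
    ... | inj₁ u∈T' | inj₁ v∈T' = T'-stable u v u∈T' v∈T'
    ... | inj₁ u∈T' | inj₂ refl = trans (proj₂ simple u s) (s≁S' (T'⊆S' u∈T'))
    ... | inj₂ refl | inj₁ v∈T' = s≁S' (T'⊆S' v∈T')
    ... | inj₂ refl | inj₂ refl = proj₁ simple s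
    covers : ∀ {u} → u ∈ S → u ∉ T' ∪ ⁅ s ⁆ → ∃ λ t → t ∈ T' ∪ ⁅ s ⁆ × Contains t (a u)
    covers {u} u∈S u∉T with u ≟ s
    ... | yes refl = ⊥-elim (u∉T (y∈p∪⁅y⁆ T' s))
    ... | no u≢s with E s u in s~u
    ... | true  = s , y∈p∪⁅y⁆ T' s , s-min u u∈S , proj₂ (proj₁ (adjacent⇔meet s u (u≢s ∘ sym)) s~u)
    ... | false with T'-covers (∈S'⁺ u∈S u≢s s~u) (u∉T ∘ p⊆p∪q ⁅ s ⁆)
    ...   | t , t∈T' , t∋au = t , p⊆p∪q ⁅ s ⁆ t∈T' , t∋au

  stableCover : ∀ S → Acc _<_ ∣ S ∣ → StableCover S
  stableCover S _ with empty⊎argmin ℚ.≤-totalPreorder a S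
  stableCover S _ | inj₁ S=∅ = record
    { T        = ⊥
    ; T⊆S      = ⊆-min S
    ; stable   = λ _ _ u∈⊥ → ⊥-elim (∉⊥ u∈⊥)
    ; nonempty = ⊥-elim ∘ S=∅
    ; covers   = λ u∈S _ → ⊥-elim (S=∅ (_ , u∈S))
    }
  stableCover S (acc rs) | inj₂ (s , s∈S , s-min) =
    leftmost-extends-cover s∈S s-min (stableCover (S ─N[ s ]) (rs ∣S─N[s]∣<∣S∣))
    where
    ∣S─N[s]∣<∣S∣ : ∣ S ─N[ s ] ∣ < ∣ S ∣
    ∣S─N[s]∣<∣S∣ = ≤-<-trans (p⊆q⇒∣p∣≤∣q∣ (p─q⊆p (S - s) (tabulate (E s)))) (x∈p⇒∣p-x∣<∣p∣ s∈S)

  cover-vertex-adjacent-to-clique : ∀ {S K} (C : StableCover S) → let open StableCover C in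
    Nonempty T → K ⊆ S ─ T → IsClique E K → ∃ λ t → t ∈ T × ∀ v → v ∈ K → v ≢ t → E t v ≡ true
  cover-vertex-adjacent-to-clique {S} {K} C T≠∅ K⊆S─T K-clique
    with empty⊎argmin (Flip.totalPreorder ℚ.≤-totalPreorder) a K
  ... | inj₁ K=∅ = proj₁ T≠∅ , proj₂ T≠∅ , λ v v∈K → ⊥-elim (K=∅ (v , v∈K))
  ... | inj₂ (k , k∈K , k-max) =
    let t , t∈T , t∋ak = covers (p─q⊆p S T (K⊆S─T k∈K)) (x∈p─q⇒x∉q S T (K⊆S─T k∈K))
    in t , t∈T , λ v v∈K v≢t →
         common-point⇒adjacent (v≢t ∘ sym) t∋ak (clique-contains-max-left-end K-clique k∈K k-max v v∈K)
    where open StableCover C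

  module _ (w : Fin n → ℚ) (W : ℚ) (stable-fits : ∀ T → IsStable E T → sumOver T w ℚ.≤ W) where

    WeightBoundingClique : Subset n → Set
    WeightBoundingClique S = Σ (Subset n) λ K → K ⊆ S × IsClique E K × sumOver S w ℚ.≤ ∣ K ∣ · W

    cover-extends-weight-bounding-clique : ∀ {S} (C : StableCover S) → Nonempty (StableCover.T C) →
      WeightBoundingClique (S ─ StableCover.T C) → WeightBoundingClique S
    cover-extends-weight-bounding-clique {S} C T≠∅ (K , K⊆S─T , K-clique , bound)
      with cover-vertex-adjacent-to-clique C T≠∅ K⊆S─T K-clique
    ... | t , t∈T , t~K = K ∪ ⁅ t ⁆ , K∪t⊆S , clique-∪-⁅⁆ (proj₂ simple) K-clique t~K , (begin
        sumOver S w                              ≡⟨ sumOver-∩-─ S T w ⟩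
        sumOver (S ∩ T) w + sumOver (S ─ T) w   ≤⟨ ℚ.+-mono-≤ (stable-fits (S ∩ T) S∩T-stable) bound ⟩
        W + ∣ K ∣ · W                            ≡⟨ cong (_· W) (sym (∣p∪⁅x⁆∣≡1+∣p∣ K t∉K)) ⟩
        ∣ K ∪ ⁅ t ⁆ ∣ · W                        ∎)
      where
      open StableCover C
      open ℚ.≤-Reasoning
      t∉K : t ∉ K
      t∉K t∈K = x∈p─q⇒x∉q S T (K⊆S─T t∈K) t∈T
      K∪t⊆S : K ∪ ⁅ t ⁆ ⊆ S
      K∪t⊆S u∈ with x∈p∪⁅y⁆⁻ K u∈
      ... | inj₁ u∈K = p─q⊆p S T (K⊆S─T u∈K)
      ... | inj₂ refl = T⊆S t∈T
      S∩T-stable : IsStable E (S ∩ T)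
      S∩T-stable u v u∈ v∈ = stable u v (p∩q⊆q S T u∈) (p∩q⊆q S T v∈)

    weight-bounding-clique : ∀ S → Acc _<_ ∣ S ∣ → WeightBoundingClique S
    weight-bounding-clique S _ with nonempty? S
    ... | no S=∅ = ⊥ {n} , ⊆-min S , (λ _ _ u∈⊥ → ⊥-elim (∉⊥ u∈⊥)) , ℚ.≤-reflexive (begin
      sumOver S w    ≡⟨ cong (λ p → sumOver p w) (Empty-unique S=∅) ⟩
      sumOver ⊥ w    ≡⟨ sumOver-⊥ w ⟩
      0ℚ             ≡⟨ cong (_· W) (sym (∣⊥∣≡0 n)) ⟩
      ∣ ⊥ {n} ∣ · W  ∎)
      where open ≡-Reasoning
    weight-bounding-clique S (acc rs) | yes S≠∅ =
      cover-extends-weight-bounding-clique C T≠∅ (weight-bounding-clique (S ─ T) (rs ∣S─T∣<∣S∣))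
      where
      C = stableCover S (acc rs)
      open StableCover C
      T≠∅ = nonempty S≠∅
      ∣S─T∣<∣S∣ : ∣ S ─ T ∣ < ∣ S ∣
      ∣S─T∣<∣S∣ = p∩q≢∅⇒∣p─q∣<∣p∣ S T (proj₁ T≠∅ , x∈p∩q⁺ (T⊆S (proj₂ T≠∅) , proj₂ T≠∅))

    clique-of-size-ceilDiv : {{W>0 : Positive W}} → (∀ v → 0ℚ ℚ.≤ w v) → ∀ S →
      Σ (Subset n) λ K → K ⊆ S × IsClique E K × + ∣ K ∣ ≡ ceilDiv (sumOver S w) W
    clique-of-size-ceilDiv w≥0 S with weight-bounding-clique S (<-wellFounded ∣ S ∣)
    ... | K , K⊆S , K-clique , bound with ceilDiv-natural-≤ (sumOver-nonNeg S w≥0) bound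
    ... | m , m≤∣K∣ , ⌈w/W⌉≡m with subset-of-size K m≤∣K∣
    ... | L , L⊆K , ∣L∣≡m = L , K⊆S ∘ L⊆K , clique-⊆ L⊆K K-clique , trans (cong +_ ∣L∣≡m) (sym ⌈w/W⌉≡m)

theorem2 : (d n : ℕ) → 1 ≤ d →
  (w : Fin d → Fin n → ℚ) → (∀ i v → 0ℚ Data.Rational.≤ w i v) →
  (W : Fin d → ℚ) → (Wpos : ∀ i → Positive (W i)) →
  (E : Fin d → Graph n) → IsPackingClass w W E →
  (i : Fin d) (S : Subset n) →
  Σ (Subset n) λ K → K ⊆ S × IsClique (E i) K ×
    + ∣ K ∣ ≡ ceilDiv (sumOver S (w i)) (W i) {{Wpos i}}
theorem2 d n _ w w≥0 W W>0 E packing i S =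
  IntervalGraph.clique-of-size-ceilDiv (simple i) (P1 i) (w i) (W i) (P2 i) {{W>0 i}} (w≥0 i) S
  where open IsPackingClass packing
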